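{- Let $p,q,k,n$ be positive integers such that $k > p$, $q\geq kp$ and $n\leq (q-p)\left(\frac{q}{kp} +1\right)^{k-p-1}$. Then for all integers $k\leq b_1\leq\ldots\leq b_n$, Avoider has a winning strategy in the game monotone-$mBox(b_1, \ldots, b_n,(p,q))$, both as the first and as the second player.
   Context: In a $(p,q)$ Avoider-Enforcer game on a finite board $X$ with target family $\mathcal F\subseteq 2^X$ played according to the monotone rules, Avoider and Enforcer alternately claim at least $p$ and at least $q$ previously unclaimed elements of $X$ per move, respectively; if fewer than $p$ (resp. $q$) unclaimed elements remain before Avoider's (resp. Enforcer's) move, he claims all of them. It is specified which player moves first. The game ends when all elements are claimed; Avoider loses if at the end he has claimed all elements of some target set, otherwise Avoider wins. The game monotone-$mBox(b_1,\ldots,b_n,(p,q))$ is this game (monotone rules) on the board consisting of the disjoint union of pairwise disjoint sets (boxes) $B_1,\ldots,B_n$ with $|B_i|=b_i$, with target sets exactly $B_1,\ldots,B_n$. -}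

module Defs where

open import Data.Nat using (ℕ; zero; suc; _+_; _*_; _∸_; _^_; _≤_; _<_)
open import Data.Fin using (Fin; zero; suc)
open import Data.Bool using (Bool; true; false; if_then_else_)
open import Data.Product using (Σ; _×_; ∃)
open import Relation.Binary.PropositionalEquality using (_≡_)
open import Relation.Nullary using (¬_)

sumFin : (m : ℕ) → (Fin m → ℕ) → ℕ
sumFin zero    f = 0
sumFin (suc m) f = f zero + sumFin m (λ i → f (suc i))

data Owner : Set where
  free avo enf : Owner

data Player : Set where
  Avoider Enforcer : Player

isFree : Owner → Bool
isFree free = true
isFree avo  = false
isFree enf  = false

-- The board of mBox(b_1,...,b_n): elements are pairs (i , j) with
-- i : Fin n (box index) and j : Fin (b i) (element of box B_i).
-- A position records the owner of every element.
Position : (n : ℕ) → (Fin n → ℕ) → Set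
Position n b = (i : Fin n) → Fin (b i) → Owner

ElemSet : (n : ℕ) → (Fin n → ℕ) → Set
ElemSet n b = (i : Fin n) → Fin (b i) → Bool

count : (n : ℕ) (b : Fin n → ℕ) → ElemSet n b → ℕ
count n b M = sumFin n (λ i → sumFin (b i) (λ j → if M i j then 1 else 0))

freeCount : (n : ℕ) (b : Fin n → ℕ) → Position n b → ℕ
freeCount n b s = count n b (λ i j → isFree (s i j))

initial : (n : ℕ) (b : Fin n → ℕ) → Position n b
initial n b i j = free

-- Monotone rules: a move claims only unclaimed elements, at least r of them;
-- if fewer than r unclaimed elements remain, it claims all of them.
LegalMove : (r n : ℕ) (b : Fin n → ℕ) → Position n b → ElemSet n b → Set
LegalMove r n b s M =
  ((i : Fin n) (j : Fin (b i)) → M i j ≡ true → s i j ≡ free)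
  × (r ≤ freeCount n b s → r ≤ count n b M)
  × (freeCount n b s < r → (i : Fin n) (j : Fin (b i)) → s i j ≡ free → M i j ≡ true)

apply : (n : ℕ) (b : Fin n → ℕ) → Owner → ElemSet n b → Position n b → Position n b
apply n b o M s i j = if M i j then o else s i j

AvoiderOwnsBox : (n : ℕ) (b : Fin n → ℕ) → Position n b → Set
AvoiderOwnsBox n b s = ∃ λ (i : Fin n) → (j : Fin (b i)) → s i j ≡ avo

-- AvoiderWins p q n b pl s : from position s with player pl to move, Avoider
-- (claiming ≥ p per move) has a strategy guaranteeing a win against every
-- strategy of Enforcer (claiming ≥ q per move) in monotone-mBox(b,(p,q)).
data AvoiderWins (p q n : ℕ) (b : Fin n → ℕ) : Player → Position n b → Set where
  finished : ∀ {pl s} → freeCount n b s ≡ 0 → ¬ AvoiderOwnsBox n b s →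
             AvoiderWins p q n b pl s
  avoMove  : ∀ {s} → 0 < freeCount n b s → (M : ElemSet n b) → LegalMove p n b s M →
             AvoiderWins p q n b Enforcer (apply n b avo M s) →
             AvoiderWins p q n b Avoider s
  enfMove  : ∀ {s} → 0 < freeCount n b s →
             ((M : ElemSet n b) → LegalMove q n b s M →
               AvoiderWins p q n b Avoider (apply n b enf M s)) →
             AvoiderWins p q n b Enforcer s

module Submission where

-- Proof by a potential function.  With a = kp and c = q + a put
-- g(t) = c^(k-t)·a^(t-1) for 1 ≤ t ≤ k and g(t) = g(k) for t ≥ k, and
-- D(t) = g(t-1) - g(t).  Then g is non-increasing, D is non-increasing on
-- t ≥ 2 and t·p·D(t) ≤ q·g(t) (with equality a·D(t) = q·g(t) for t ≤ k).
-- A box is live while Enforcer owns none of its elements; the potential of a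
-- position is Φ = Σ g(free elements of B) over the live boxes B, and Avoider
-- keeps Φ ≤ (q-p)·g(p+1) with at least p+1 free elements in every live box.
-- On his move Avoider takes every free element of a dead box and tops the move
-- up to p elements by repeatedly removing one element from a live box of
-- maximal free size; this raises Φ by at most p·D(T), T the final maximal
-- size.  Enforcer's reply of q elements inside live boxes of free size ≤ T
-- lowers Φ by at least q·g(T)/T ≥ p·D(T).  When no such move exists, the
-- bound on Φ shows that fewer than q live boxes remain; Avoider then leaves
-- exactly one free element in each of them and Enforcer has to take them all.

open import Defs
open import Data.Nat using (ℕ; _+_; _*_; _∸_; _^_; _≤_; _<_; _>_; _≥_)
open import Data.Fin using (Fin)
open import Data.Product using (_×_)
import Data.Fin as F

open import Data.Nat
open import Data.Nat.Properties
open import Data.Bool using (Bool; true; false; if_then_else_; not; _∧_)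
open import Data.Fin using (zero; suc) renaming (_≟_ to _≟F_)
import Data.Fin.Properties as FinP
open import Data.Bool.Properties using (not-injective)
open import Data.Product using (∃; _,_; proj₁; proj₂)
open import Data.Sum using (_⊎_; inj₁; inj₂)
open import Data.Empty using (⊥-elim)
open import Function using (_∘_; case_of_)
open import Relation.Binary.PropositionalEquality
open import Relation.Nullary using (¬_; Dec; yes; no)
open import Data.Nat.Tactic.RingSolver using (solve-∀)
open import Algebra.Properties.CommutativeSemigroup +-commutativeSemigroup
  using (interchange; xy∙z≈zy∙x; xy∙z≈x∙zy; x∙yz≈xz∙y)


sumFin-cong : ∀ m {f h : Fin m → ℕ} → (∀ i → f i ≡ h i) → sumFin m f ≡ sumFin m h
sumFin-cong zero    eq = refl
sumFin-cong (suc m) eq = cong₂ _+_ (eq zero) (sumFin-cong m (λ i → eq (suc i)))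

sumFin-mono : ∀ m {f h : Fin m → ℕ} → (∀ i → f i ≤ h i) → sumFin m f ≤ sumFin m h
sumFin-mono zero    le = z≤n
sumFin-mono (suc m) le = +-mono-≤ (le zero) (sumFin-mono m (λ i → le (suc i)))

sumFin-+ : ∀ m (f h : Fin m → ℕ) → sumFin m (λ i → f i + h i) ≡ sumFin m f + sumFin m h
sumFin-+ zero    f h = refl
sumFin-+ (suc m) f h =
  trans (cong (f zero + h zero +_) (sumFin-+ m (λ i → f (suc i)) (λ i → h (suc i))))
        (interchange (f zero) (h zero) _ _)

sumFin-* : ∀ m c (f : Fin m → ℕ) → sumFin m (λ i → c * f i) ≡ c * sumFin m f
sumFin-* zero    c f = sym (*-zeroʳ c)
sumFin-* (suc m) c f =
  trans (cong (c * f zero +_) (sumFin-* m c (λ i → f (suc i))))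
        (sym (*-distribˡ-+ c (f zero) _))

sumFin-const : ∀ m c → sumFin m (λ _ → c) ≡ m * c
sumFin-const zero    c = refl
sumFin-const (suc m) c = cong (c +_) (sumFin-const m c)

sumFin-zero : ∀ m {f : Fin m → ℕ} → (∀ i → f i ≡ 0) → sumFin m f ≡ 0
sumFin-zero m eq = trans (sumFin-cong m eq) (trans (sumFin-const m 0) (*-zeroʳ m))

term≤sumFin : ∀ m (f : Fin m → ℕ) i → f i ≤ sumFin m f
term≤sumFin (suc m) f zero    = m≤m+n _ _
term≤sumFin (suc m) f (suc i) = ≤-trans (term≤sumFin m (λ j → f (suc j)) i) (m≤n+m _ _)

sumFin-zero⁻¹ : ∀ m (f : Fin m → ℕ) → sumFin m f ≡ 0 → ∀ i → f i ≡ 0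
sumFin-zero⁻¹ m f eq i = n≤0⇒n≡0 (subst (f i ≤_) eq (term≤sumFin m f i))

sumFin-witness : ∀ m (f : Fin m → ℕ) → 0 < sumFin m f → ∃ λ i → 0 < f i
sumFin-witness (suc m) f pos with f zero in eq
... | suc _ = zero , subst (0 <_) (sym eq) z<s
... | zero with sumFin-witness m (λ i → f (suc i)) pos
...   | i , fi = suc i , fi

sumFin-update : ∀ m (h h' : Fin m → ℕ) (i : Fin m) → (∀ j → ¬ j ≡ i → h j ≡ h' j) →
                sumFin m h + h' i ≡ sumFin m h' + h i
sumFin-update (suc m) h h' zero agree =
  trans (cong (λ x → h zero + x + h' zero) (sumFin-cong m (λ j → agree (suc j) (λ ()))))
        (xy∙z≈zy∙x (h zero) _ (h' zero))
sumFin-update (suc m) h h' (suc i) agree rewrite agree zero (λ ()) =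
  trans (+-assoc (h' zero) _ _)
    (trans (cong (h' zero +_) (sumFin-update m (λ j → h (suc j)) (λ j → h' (suc j)) i
                                (λ j j≢i → agree (suc j) (j≢i ∘ FinP.suc-injective))))
           (sym (+-assoc (h' zero) _ _)))

if-true : ∀ {A : Set} {c} {x y : A} → c ≡ true → (if c then x else y) ≡ x
if-true refl = refl

if-false : ∀ {A : Set} {c} {x y : A} → c ≡ false → (if c then x else y) ≡ y
if-false refl = refl

sumOn : ∀ {m} → (Fin m → Bool) → (Fin m → ℕ) → ℕ
sumOn {m} l f = sumFin m (λ i → if l i then f i else 0)

sumOn-cong : ∀ {m} (l : Fin m → Bool) {f h : Fin m → ℕ} →
             (∀ i → l i ≡ true → f i ≡ h i) → sumOn l f ≡ sumOn l h
sumOn-cong {m} l {f} {h} eq = sumFin-cong m term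
  where
  term : ∀ i → (if l i then f i else 0) ≡ (if l i then h i else 0)
  term i with l i in li
  ... | true  = eq i li
  ... | false = refl

sumOn-mask : ∀ {m} {l l' : Fin m → Bool} (f : Fin m → ℕ) → (∀ i → l i ≡ l' i) →
             sumOn l f ≡ sumOn l' f
sumOn-mask {m} f same = sumFin-cong m (λ i → cong (λ x → if x then f i else 0) (same i))

sumOn-mono : ∀ {m} (l : Fin m → Bool) {f h : Fin m → ℕ} →
             (∀ i → l i ≡ true → f i ≤ h i) → sumOn l f ≤ sumOn l h
sumOn-mono {m} l {f} {h} le = sumFin-mono m term
  where
  term : ∀ i → (if l i then f i else 0) ≤ (if l i then h i else 0)
  term i with l i in li
  ... | true  = le i li
  ... | false = z≤n

sumOn-* : ∀ {m} (l : Fin m → Bool) c (f : Fin m → ℕ) → sumOn l (λ i → c * f i) ≡ c * sumOn l f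
sumOn-* {m} l c f = trans (sumFin-cong m term) (sumFin-* m c _)
  where
  term : ∀ i → (if l i then c * f i else 0) ≡ c * (if l i then f i else 0)
  term i with l i
  ... | true  = refl
  ... | false = sym (*-zeroʳ c)

sumOn-+ : ∀ {m} (l : Fin m → Bool) (f h : Fin m → ℕ) →
          sumOn l (λ i → f i + h i) ≡ sumOn l f + sumOn l h
sumOn-+ {m} l f h = trans (sumFin-cong m term) (sumFin-+ m _ _)
  where
  term : ∀ i → (if l i then f i + h i else 0) ≡ (if l i then f i else 0) + (if l i then h i else 0)
  term i with l i
  ... | true  = refl
  ... | false = refl

term≤sumOn : ∀ {m} (l : Fin m → Bool) (f : Fin m → ℕ) i → l i ≡ true → f i ≤ sumOn l f
term≤sumOn {m} l f i li =
  ≤-trans (≤-reflexive (sym (if-true li)))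
          (term≤sumFin m (λ j → if l j then f j else 0) i)

sumOn-witness : ∀ {m} (l : Fin m → Bool) (f : Fin m → ℕ) → 0 < sumOn l f →
                ∃ λ i → l i ≡ true × 0 < f i
sumOn-witness {m} l f pos with sumFin-witness m _ pos
... | i , fi with l i in li
...   | true = i , li , fi

sumOn-zero : ∀ {m} (l : Fin m → Bool) {f : Fin m → ℕ} → (∀ i → l i ≡ true → f i ≡ 0) →
             sumOn l f ≡ 0
sumOn-zero {m} l eq = trans (sumOn-cong l eq) (sumFin-zero m term)
  where
  term : ∀ i → (if l i then 0 else 0) ≡ 0
  term i with l i
  ... | true  = refl
  ... | false = refl

sumFin-cases : ∀ {m} (l : Fin m → Bool) (x y : Fin m → ℕ) →
               sumFin m (λ i → if l i then x i else y i) ≡ sumOn (not ∘ l) y + sumOn l x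
sumFin-cases {m} l x y = trans (sumFin-cong m term) (sumFin-+ m _ _)
  where
  term : ∀ i → (if l i then x i else y i) ≡
               (if not (l i) then y i else 0) + (if l i then x i else 0)
  term i with l i
  ... | true  = refl
  ... | false = sym (+-identityʳ (y i))

-- The weight of a live box with t free elements, for parameters k, p, q.
module Weights (k p q : ℕ) {{_ : NonZero k}} {{_ : NonZero p}} where

  a c : ℕ
  a = k * p
  c = q + a

  instance
    a≢0 : NonZero a
    a≢0 = m*n≢0 k p
    c≢0 : NonZero c
    c≢0 = >-nonZero (<-≤-trans (>-nonZero⁻¹ a) (m≤n+m a q))

  g : ℕ → ℕ
  g t = c ^ (k ∸ t) * a ^ pred (t ⊓ k)

  D : ℕ → ℕ
  D t = g (pred t) ∸ g t

  g-pos : ∀ t → 0 < g t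
  g-pos t = *-mono-≤ (m^n>0 c (k ∸ t)) (m^n>0 a (pred (t ⊓ k)))

  g-below : ∀ t → t ≤ k → g t ≡ c ^ (k ∸ t) * a ^ pred t
  g-below t t≤k = cong (λ x → c ^ (k ∸ t) * a ^ pred x) (m≤n⇒m⊓n≡m t≤k)

  g-beyond : ∀ t → k ≤ t → g t ≡ g k
  g-beyond t k≤t =
    trans (cong₂ (λ x y → c ^ x * a ^ pred y) (m≤n⇒m∸n≡0 k≤t) (m≥n⇒m⊓n≡n k≤t))
          (sym (cong₂ (λ x y → c ^ x * a ^ pred y) (n∸n≡0 k) (⊓-idem k)))

  g-step : ∀ t → 2 ≤ t → t ≤ k → a * g (pred t) ≡ c * g t
  g-step t@(suc (suc u)) (s≤s (s≤s z≤n)) t≤k = begin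
    a * g (suc u)                            ≡⟨ cong (a *_) (g-below (suc u) (<⇒≤ t≤k)) ⟩
    a * (c ^ (k ∸ suc u) * a ^ u)            ≡⟨ cong (λ x → a * (c ^ x * a ^ u)) (+-∸-assoc 1 t≤k) ⟩
    a * (c * c ^ (k ∸ t) * a ^ u)            ≡⟨ regroup a c (c ^ (k ∸ t)) (a ^ u) ⟩
    c * (c ^ (k ∸ t) * (a * a ^ u))          ≡⟨ cong (c *_) (sym (g-below t t≤k)) ⟩
    c * g t                                  ∎
    where
    open ≡-Reasoning
    regroup : ∀ a c C A → a * (c * C * A) ≡ c * (C * (a * A))
    regroup = solve-∀

  -- Hence g(t+1) ≤ g(t) for t ≥ 1, since a ≤ c.
  g-suc-≤ : ∀ t → 1 ≤ t → g (suc t) ≤ g t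
  g-suc-≤ t 1≤t with suc t ≤? k
  ... | yes t<k = *-cancelˡ-≤ a (begin
        a * g (suc t) ≤⟨ *-monoˡ-≤ (g (suc t)) (m≤n+m a q) ⟩
        c * g (suc t) ≡⟨ sym (g-step (suc t) (s≤s 1≤t) t<k) ⟩
        a * g t       ∎)
    where open ≤-Reasoning
  ... | no t≮k = ≤-reflexive (trans (g-beyond (suc t) (<⇒≤ k≤t+1))
                                    (sym (g-beyond t (s≤s⁻¹ k≤t+1))))
    where k≤t+1 = ≰⇒> t≮k

  g-anti : ∀ t u → 1 ≤ t → t ≤ u → g u ≤ g t
  g-anti t u 1≤t t≤u with m≤n⇒∃[o]m+o≡n t≤u
  ... | o , refl = go o
    where
    go : ∀ o → g (t + o) ≤ g t
    go zero    = ≤-reflexive (cong g (+-identityʳ t))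
    go (suc o) = ≤-trans (≤-reflexive (cong g (+-suc t o)))
                         (≤-trans (g-suc-≤ (t + o) (≤-trans 1≤t (m≤m+n t o))) (go o))

  g-pred : ∀ t → 2 ≤ t → g (pred t) ≡ g t + D t
  g-pred (suc t) (s≤s 1≤t) = sym (m+[n∸m]≡n (g-suc-≤ t 1≤t))

  a*D≡q*g : ∀ t → 2 ≤ t → t ≤ k → a * D t ≡ q * g t
  a*D≡q*g t 2≤t t≤k = begin
    a * (g (pred t) ∸ g t)  ≡⟨ *-distribˡ-∸ a (g (pred t)) (g t) ⟩
    a * g (pred t) ∸ a * g t ≡⟨ cong (_∸ a * g t) (g-step t 2≤t t≤k) ⟩
    c * g t ∸ a * g t        ≡⟨ sym (*-distribʳ-∸ (g t) c a) ⟩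
    (c ∸ a) * g t            ≡⟨ cong (_* g t) (m+n∸n≡m q a) ⟩
    q * g t                  ∎
    where open ≡-Reasoning

  D-beyond : ∀ t → k < t → D t ≡ 0
  D-beyond (suc t) (s≤s k≤t) =
    trans (cong (_∸ g (suc t)) (trans (g-beyond t k≤t) (sym (g-beyond (suc t) (m≤n⇒m≤1+n k≤t)))))
          (n∸n≡0 (g (suc t)))

  -- The inequality that makes Enforcer's moves pay for Avoider's trimming.
  D-bound : ∀ t → 2 ≤ t → t * p * D t ≤ q * g t
  D-bound t 2≤t with t ≤? k
  ... | yes t≤k = ≤-trans (*-monoˡ-≤ (D t) (*-monoˡ-≤ p t≤k)) (≤-reflexive (a*D≡q*g t 2≤t t≤k))
  ... | no t≰k rewrite D-beyond t (≰⇒> t≰k) | *-zeroʳ (t * p) = z≤n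

  D-anti : ∀ t u → 2 ≤ t → t ≤ u → D u ≤ D t
  D-anti t u 2≤t t≤u with u ≤? k
  ... | yes u≤k = *-cancelˡ-≤ a (begin
        a * D u ≡⟨ a*D≡q*g u (≤-trans 2≤t t≤u) u≤k ⟩
        q * g u ≤⟨ *-monoʳ-≤ q (g-anti t u (≤-trans (s≤s z≤n) 2≤t) t≤u) ⟩
        q * g t ≡⟨ sym (a*D≡q*g t 2≤t (≤-trans t≤u u≤k)) ⟩
        a * D t ∎)
    where open ≤-Reasoning
  ... | no u≰k rewrite D-beyond u (≰⇒> u≰k) = z≤n

-- Maximum of f over the indices selected by l (0 if none is selected).
maxOn : ∀ {m} → (Fin m → Bool) → (Fin m → ℕ) → ℕ
maxOn {zero}  l f = 0
maxOn {suc m} l f = (if l zero then f zero else 0) ⊔ maxOn (λ i → l (suc i)) (λ i → f (suc i))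

maxOn-ub : ∀ {m} (l : Fin m → Bool) (f : Fin m → ℕ) i → l i ≡ true → f i ≤ maxOn l f
maxOn-ub l f zero    li = ≤-trans (≤-reflexive (sym (if-true li)))
                                  (m≤m⊔n _ _)
maxOn-ub l f (suc i) li = ≤-trans (maxOn-ub _ _ i li) (m≤n⊔m _ _)

maxOn-mono : ∀ {m} (l : Fin m → Bool) (f h : Fin m → ℕ) → (∀ i → f i ≤ h i) →
             maxOn l f ≤ maxOn l h
maxOn-mono {zero}  l f h le = z≤n
maxOn-mono {suc m} l f h le = ⊔-mono-≤ (head (l zero)) (maxOn-mono _ _ _ (λ i → le (suc i)))
  where
  head : ∀ x → (if x then f zero else 0) ≤ (if x then h zero else 0)
  head true  = le zero
  head false = z≤n

maxOn-attained : ∀ {m} (l : Fin m → Bool) (f : Fin m → ℕ) → 0 < maxOn l f →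
                 ∃ λ i → l i ≡ true × f i ≡ maxOn l f
maxOn-attained {suc m} l f pos
  with l zero in l0 | ≤-total (maxOn (λ i → l (suc i)) (λ i → f (suc i))) (f zero)
... | true  | inj₁ rest≤f0 = zero , l0 , sym (m≥n⇒m⊔n≡m rest≤f0)
... | true  | inj₂ f0≤rest with maxOn-attained _ _ (subst (0 <_) (m≤n⇒m⊔n≡n f0≤rest) pos)
...   | i , li , fi = suc i , li , trans fi (sym (m≤n⇒m⊔n≡n f0≤rest))
maxOn-attained {suc m} l f pos | false | _ with maxOn-attained _ _ pos
...   | i , li , fi = suc i , li , fi

decAt : ∀ {m} → (Fin m → ℕ) → Fin m → Fin m → ℕ
decAt f i j with j ≟F i
... | yes _ = pred (f j)
... | no  _ = f j

decAt-at : ∀ {m} (f : Fin m → ℕ) i → decAt f i i ≡ pred (f i)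
decAt-at f i with i ≟F i
... | yes _   = refl
... | no  i≢i = ⊥-elim (i≢i refl)

decAt-off : ∀ {m} (f : Fin m → ℕ) i j → ¬ j ≡ i → decAt f i j ≡ f j
decAt-off f i j j≢i with j ≟F i
... | yes j≡i = ⊥-elim (j≢i j≡i)
... | no  _   = refl

decAt-≤ : ∀ {m} (f : Fin m → ℕ) i j → decAt f i j ≤ f j
decAt-≤ f i j with j ≟F i
... | yes _ = pred[n]≤n
... | no  _ = ≤-refl

sumOn-decAt : ∀ {m} (l : Fin m → Bool) (F : Fin m → ℕ → ℕ) (f : Fin m → ℕ) i → l i ≡ true →
              sumOn l (λ j → F j (decAt f i j)) + F i (f i) ≡
              sumOn l (λ j → F j (f j)) + F i (pred (f i))
sumOn-decAt {m} l F f i li = begin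
  sumFin m new + F i (f i)        ≡⟨ cong (sumFin m new +_) (sym selected) ⟩
  sumFin m new + old i            ≡⟨ sumFin-update m new old i agree ⟩
  sumFin m old + new i            ≡⟨ cong (sumFin m old +_) (trans selected (cong (F i) (decAt-at f i))) ⟩
  sumFin m old + F i (pred (f i)) ∎
  where
  open ≡-Reasoning
  new old : Fin m → ℕ
  new j = if l j then F j (decAt f i j) else 0
  old j = if l j then F j (f j) else 0
  selected : ∀ {x y} → (if l i then x else y) ≡ x
  selected = if-true li
  agree : ∀ j → ¬ j ≡ i → new j ≡ old j
  agree j j≢i = cong (λ y → if l j then F j y else 0) (decAt-off f i j j≢i)

∸-pos⇒< : ∀ {x y} → 0 < x ∸ y → y < x
∸-pos⇒< pos = ≰⇒> (λ x≤y → <-irrefl (sym (m≤n⇒m∸n≡0 x≤y)) pos)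

∸-pred : ∀ {x t} → 1 ≤ t → t ≤ x → x ∸ pred t ≡ suc (x ∸ t)
∸-pred {t = suc _} _ t≤x = +-∸-assoc 1 t≤x

-- Avoider's trimming of the live boxes, acting on the vector f of their free
-- sizes (the boxes selected by l): one element at a time is removed from a box
-- of maximal size, never bringing a box below p+1.  Removing e elements this
-- way raises the potential by at most e·D(T), T the final maximal size.
module Trimming (k p q : ℕ) {{_ : NonZero k}} {{_ : NonZero p}}
                {n : ℕ} (l : Fin n → Bool) where
  open Weights k p q

  potential : (Fin n → ℕ) → ℕ
  potential f = sumOn l (λ i → g (f i))

  slack : (Fin n → ℕ) → ℕ
  slack f = sumOn l (λ i → f i ∸ suc p)

  removed : (Fin n → ℕ) → (Fin n → ℕ) → ℕ
  removed f f' = sumOn l (λ i → f i ∸ f' i)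

  Floor : (Fin n → ℕ) → Set
  Floor f = ∀ i → l i ≡ true → suc p ≤ f i

  record Trimmed (f : Fin n → ℕ) (e : ℕ) : Set where
    field
      result     : Fin n → ℕ
      below      : ∀ i → result i ≤ f i
      floor      : Floor result
      removed≡   : removed f result ≡ e
      slack≡     : slack result + e ≡ slack f
      potential≤ : potential result ≤ potential f + e * D (maxOn l result)

  slack-witness : ∀ h → 0 < slack h → ∃ λ j → l j ≡ true × suc (suc p) ≤ h j
  slack-witness h pos with sumOn-witness l _ pos
  ... | j , lj , hj = j , lj , ∸-pos⇒< hj

  trimIndex : ∀ h → 0 < slack h → ∃ λ i → l i ≡ true × h i ≡ maxOn l h × suc (suc p) ≤ h i
  trimIndex h pos with slack-witness h pos
  ... | j , lj , big with maxOn-attained l h (≤-trans z<s (≤-trans big (maxOn-ub l h j lj)))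
  ...   | i , li , hi≡max =
          i , li , hi≡max , ≤-trans big (≤-trans (maxOn-ub l h j lj) (≤-reflexive (sym hi≡max)))

  removed-step : ∀ f h i → l i ≡ true → (∀ j → h j ≤ f j) → 1 ≤ h i →
                 removed f (decAt h i) ≡ suc (removed f h)
  removed-step f h i li h≤f 1≤hi = +-cancelʳ-≡ (f i ∸ h i) _ _ (begin
    removed f (decAt h i) + (f i ∸ h i) ≡⟨ sumOn-decAt l (λ j y → f j ∸ y) h i li ⟩
    removed f h + (f i ∸ pred (h i))    ≡⟨ cong (removed f h +_) (∸-pred 1≤hi (h≤f i)) ⟩
    removed f h + suc (f i ∸ h i)       ≡⟨ +-suc _ _ ⟩
    suc (removed f h) + (f i ∸ h i)     ∎)
    where open ≡-Reasoning

  slack-step : ∀ h i → l i ≡ true → suc (suc p) ≤ h i → suc (slack (decAt h i)) ≡ slack h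
  slack-step h i li big = +-cancelʳ-≡ (pred (h i) ∸ suc p) _ _ (begin
    suc (slack (decAt h i)) + (pred (h i) ∸ suc p) ≡⟨ sym (+-suc _ _) ⟩
    slack (decAt h i) + suc (pred (h i) ∸ suc p)   ≡⟨ cong (slack (decAt h i) +_) (sym (step big)) ⟩
    slack (decAt h i) + (h i ∸ suc p)              ≡⟨ sumOn-decAt l (λ _ y → y ∸ suc p) h i li ⟩
    slack h + (pred (h i) ∸ suc p)                 ∎)
    where
    open ≡-Reasoning
    step : ∀ {t} → suc (suc p) ≤ t → t ∸ suc p ≡ suc (pred t ∸ suc p)
    step {suc t} (s≤s p<t) = +-∸-assoc 1 p<t

  potential-step : ∀ h i → l i ≡ true → 2 ≤ h i → potential (decAt h i) ≡ potential h + D (h i)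
  potential-step h i li 2≤hi = +-cancelʳ-≡ (g (h i)) _ _ (begin
    potential (decAt h i) + g (h i)   ≡⟨ sumOn-decAt l (λ _ y → g y) h i li ⟩
    potential h + g (pred (h i))      ≡⟨ cong (potential h +_) (g-pred (h i) 2≤hi) ⟩
    potential h + (g (h i) + D (h i)) ≡⟨ x∙yz≈xz∙y (potential h) (g (h i)) (D (h i)) ⟩
    potential h + D (h i) + g (h i)   ∎)
    where open ≡-Reasoning

  floor-step : ∀ h i → Floor h → suc (suc p) ≤ h i → Floor (decAt h i)
  floor-step h i floor big j lj = byIndex (j ≟F i)
    where
    byIndex : Dec (j ≡ i) → suc p ≤ decAt h i j
    byIndex (yes j≡i) = subst (λ x → suc p ≤ decAt h i x) (sym j≡i)
                              (subst (suc p ≤_) (sym (decAt-at h i)) (suc[m]≤n⇒m≤pred[n] big))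
    byIndex (no j≢i)  = subst (suc p ≤_) (sym (decAt-off h i j j≢i)) (floor j lj)

  remaining-slack : ∀ {f e} (r : Trimmed f e) → e < slack f → 0 < slack (Trimmed.result r)
  remaining-slack {e = e} r e<slack =
    +-cancelʳ-< e 0 _ (subst (e <_) (sym (Trimmed.slack≡ r)) e<slack)

  trim-more : ∀ {f e} (r : Trimmed f e) → e < slack f → Trimmed f (suc e)
  trim-more {f} {e} r e<slack with trimIndex (Trimmed.result r) (remaining-slack r e<slack)
  ... | i , li , hi≡max , big = record
    { result     = h'
    ; below      = λ j → ≤-trans (decAt-≤ h i j) (below j)
    ; floor      = floor'
    ; removed≡   = trans (removed-step f h i li below (≤-trans z<s big)) (cong suc removed≡)
    ; slack≡     = trans (+-suc _ e) (trans (cong (_+ e) (slack-step h i li big)) slack≡)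
    ; potential≤ = potential≤'
    }
    where
    open Trimmed r renaming (result to h)
    h' : Fin n → ℕ
    h' = decAt h i
    floor' : Floor h'
    floor' = floor-step h i floor big
    -- The step costs D(h i), and h i is at least the new maximum.
    D-step : D (h i) ≤ D (maxOn l h')
    D-step = D-anti (maxOn l h') (h i)
               (≤-trans (s≤s (>-nonZero⁻¹ p)) (≤-trans (floor' i li) (maxOn-ub l h' i li)))
               (≤-trans (maxOn-mono l h' h (decAt-≤ h i)) (≤-reflexive (sym hi≡max)))
    potential≤' : potential h' ≤ potential f + suc e * D (maxOn l h')
    potential≤' = begin
      potential h'                             ≡⟨ potential-step h i li (≤-trans (s≤s (s≤s z≤n)) big) ⟩
      potential h + D (h i)                    ≤⟨ +-mono-≤ potential≤ D-step ⟩
      potential f + e * D (maxOn l h) + D T'   ≤⟨ +-monoˡ-≤ (D T') (+-monoʳ-≤ _ (*-monoʳ-≤ e D-max)) ⟩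
      potential f + e * D T' + D T'            ≡⟨ xy∙z≈x∙zy (potential f) (e * D T') (D T') ⟩
      potential f + suc e * D T'               ∎
      where
      open ≤-Reasoning
      T' : ℕ
      T' = maxOn l h'
      D-max : D (maxOn l h) ≤ D T'
      D-max = ≤-trans (≤-reflexive (cong D (sym hi≡max))) D-step

  trim : ∀ f e → Floor f → e ≤ slack f → Trimmed f e
  trim f zero    fl _ = record
    { result = f ; below = λ _ → ≤-refl ; floor = fl
    ; removed≡ = sumOn-zero l (λ i _ → n∸n≡0 (f i)) ; slack≡ = +-identityʳ _
    ; potential≤ = m≤m+n _ _ }
  trim f (suc e) fl e<slack = trim-more (trim f e fl (<⇒≤ e<slack)) e<slack

ind : Bool → ℕ
ind x = if x then 1 else 0

cnt : (m : ℕ) → (Fin m → Bool) → ℕ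
cnt m P = sumFin m (λ j → ind (P j))

cnt-pos : ∀ m (P : Fin m → Bool) j → P j ≡ true → 0 < cnt m P
cnt-pos m P j Pj = ≤-trans (≤-reflexive (cong ind (sym Pj))) (term≤sumFin m (λ j → ind (P j)) j)

cnt-witness : ∀ m (P : Fin m → Bool) → 0 < cnt m P → ∃ λ j → P j ≡ true
cnt-witness m P pos with sumFin-witness m _ pos
... | j , Pj with P j in eq
...   | true = j , eq

-- The first x elements satisfying P (all of them if there are fewer).
selFirst : (m : ℕ) → (Fin m → Bool) → ℕ → Fin m → Bool
selFirst (suc m) P x zero    = P zero ∧ (if x ≡ᵇ 0 then false else true)
selFirst (suc m) P x (suc j) = selFirst m (λ i → P (suc i)) (if P zero then pred x else x) j

selFirst-⊆ : ∀ m P x j → selFirst m P x j ≡ true → P j ≡ true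
selFirst-⊆ (suc m) P x zero h with P zero
... | true  = refl
... | false = h
selFirst-⊆ (suc m) P x (suc j) h = selFirst-⊆ m _ _ j h

selFirst-cnt : ∀ m P x → cnt m (selFirst m P x) ≡ x ⊓ cnt m P
selFirst-cnt zero    P x = sym (⊓-zeroʳ x)
selFirst-cnt (suc m) P x with P zero
selFirst-cnt (suc m) P zero    | true  = selFirst-cnt m _ 0
selFirst-cnt (suc m) P (suc x) | true  = cong suc (selFirst-cnt m _ x)
selFirst-cnt (suc m) P x       | false = selFirst-cnt m _ x

isEnf : Owner → Bool
isEnf enf = true
isEnf _   = false

isFree-true : ∀ {o} → isFree o ≡ true → o ≡ free
isFree-true {free} _ = refl

module Board (n : ℕ) (b : Fin n → ℕ) where

  fr en : Position n b → Fin n → ℕ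
  fr s i = cnt (b i) (λ j → isFree (s i j))
  en s i = cnt (b i) (λ j → isEnf (s i j))

  inBox : ElemSet n b → Fin n → ℕ
  inBox M i = cnt (b i) (M i)

  OnFree : Position n b → ElemSet n b → Set
  OnFree s M = ∀ i j → M i j ≡ true → s i j ≡ free

  claim-fr : ∀ o → isFree o ≡ false → ∀ s M → OnFree s M → ∀ i →
             fr (apply n b o M s) i + inBox M i ≡ fr s i
  claim-fr o o-taken s M onFree i =
    trans (sym (sumFin-+ (b i) _ _)) (sumFin-cong (b i) (λ j → element (M i j) (onFree i j)))
    where
    element : ∀ {x} (m : Bool) → (m ≡ true → x ≡ free) →
              ind (isFree (if m then o else x)) + ind m ≡ ind (isFree x)
    element true  m⇒free rewrite m⇒free refl | o-taken = refl
    element false _ = +-identityʳ _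

  claim-freeCount : ∀ o → isFree o ≡ false → ∀ s M → OnFree s M →
                    freeCount n b (apply n b o M s) + count n b M ≡ freeCount n b s
  claim-freeCount o o-taken s M onFree =
    trans (sym (sumFin-+ n _ _)) (sumFin-cong n (claim-fr o o-taken s M onFree))

  avo-en : ∀ s M → OnFree s M → ∀ i → en (apply n b avo M s) i ≡ en s i
  avo-en s M onFree i = sumFin-cong (b i) (λ j → element (M i j) (onFree i j))
    where
    element : ∀ {x} (m : Bool) → (m ≡ true → x ≡ free) →
              ind (isEnf (if m then avo else x)) ≡ ind (isEnf x)
    element true  m⇒free rewrite m⇒free refl = refl
    element false _ = refl

  enf-en : ∀ s M → OnFree s M → ∀ i → en (apply n b enf M s) i ≡ en s i + inBox M i
  enf-en s M onFree i =
    trans (sumFin-cong (b i) (λ j → element (M i j) (onFree i j))) (sumFin-+ (b i) _ _)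
    where
    element : ∀ {x} (m : Bool) → (m ≡ true → x ≡ free) →
              ind (isEnf (if m then enf else x)) ≡ ind (isEnf x) + ind m
    element true  m⇒free rewrite m⇒free refl = refl
    element false _ = sym (+-identityʳ _)

  claim-all : ∀ o → isFree o ≡ false → ∀ s M → (∀ i j → s i j ≡ free → M i j ≡ true) →
              freeCount n b (apply n b o M s) ≡ 0
  claim-all o o-taken s M all = sumFin-zero n (λ i → sumFin-zero (b i) (λ j → element i j))
    where
    element : ∀ i j → ind (isFree (if M i j then o else s i j)) ≡ 0
    element i j with M i j in m | s i j in x
    ... | true  | _    rewrite o-taken = refl
    ... | false | free = case trans (sym (all i j x)) m of λ ()
    ... | false | avo  = refl
    ... | false | enf  = refl

  fr-witness : ∀ s i → 0 < fr s i → ∃ λ j → s i j ≡ free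
  fr-witness s i pos with cnt-witness (b i) _ pos
  ... | j , free-j = j , isFree-true free-j

  count≤freeCount : ∀ s M → OnFree s M → count n b M ≤ freeCount n b s
  count≤freeCount s M onFree = subst (count n b M ≤_) (claim-freeCount avo refl s M onFree) (m≤n+m _ _)

  large-legal : ∀ r s M → OnFree s M → r ≤ count n b M → LegalMove r n b s M
  large-legal r s M onFree r≤M = onFree , (λ _ → r≤M) , λ few →
    ⊥-elim (<-irrefl refl (<-≤-trans few (≤-trans r≤M (count≤freeCount s M onFree))))

  takeAll-legal : ∀ r s M → OnFree s M → (∀ i j → s i j ≡ free → M i j ≡ true) →
                  LegalMove r n b s M
  takeAll-legal r s M onFree all = onFree , enough , λ _ → all
    where
    enough : r ≤ freeCount n b s → r ≤ count n b M
    enough r≤F = subst (r ≤_) (trans (sym (claim-freeCount avo refl s M onFree))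
                                     (cong (_+ count n b M) (claim-all avo refl s M all))) r≤F

  legal-nonempty : ∀ r s M → 0 < r → LegalMove r n b s M → 0 < freeCount n b s → 0 < count n b M
  legal-nonempty r s M 0<r (onFree , enough , all) F>0 with r ≤? freeCount n b s
  ... | yes r≤F = <-≤-trans 0<r (enough r≤F)
  ... | no  r≰F with sumFin-witness n (fr s) F>0
  ...   | i , fr-pos with fr-witness s i fr-pos
  ...     | j , free-j = ≤-trans (cnt-pos (b i) (M i) j (all (≰⇒> r≰F) i j free-j))
                                 (term≤sumFin n (inBox M) i)

  claim-shrinks : ∀ o → isFree o ≡ false → ∀ s M → OnFree s M → 0 < count n b M →
                  freeCount n b (apply n b o M s) < freeCount n b s
  claim-shrinks o o-taken s M onFree M>0 =
    subst (freeCount n b (apply n b o M s) <_) (claim-freeCount o o-taken s M onFree) (m<m+n _ M>0)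

  owned-fr : ∀ s i → (∀ j → s i j ≡ avo) → fr s i ≡ 0
  owned-fr s i owned = sumFin-zero (b i) (λ j → cong (ind ∘ isFree) (owned j))

  owned-en : ∀ s i → (∀ j → s i j ≡ avo) → en s i ≡ 0
  owned-en s i owned = sumFin-zero (b i) (λ j → cong (ind ∘ isEnf) (owned j))

someOrNone : ∀ {m} (l : Fin m → Bool) → (∃ λ i → l i ≡ true) ⊎ (∀ i → l i ≡ false)
someOrNone {zero}  l = inj₂ (λ ())
someOrNone {suc m} l with l zero in l0 | someOrNone (λ i → l (suc i))
... | true  | _                = inj₁ (zero , l0)
... | false | inj₁ (i , li)    = inj₁ (suc i , li)
... | false | inj₂ none        = inj₂ λ { zero → l0 ; (suc i) → none i }

≡ᵇ0⇒≡0 : ∀ m → (m ≡ᵇ 0) ≡ true → m ≡ 0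
≡ᵇ0⇒≡0 zero _ = refl

≡0⇒≡ᵇ0 : ∀ {m} → m ≡ 0 → (m ≡ᵇ 0) ≡ true
≡0⇒≡ᵇ0 refl = refl

module Strategy (k p q : ℕ) {{_ : NonZero k}} {{_ : NonZero p}} (kp≤q : k * p ≤ q)
                (n : ℕ) (b : Fin n → ℕ) where
  open Weights k p q
  open Board n b

  p≤q : p ≤ q
  p≤q = ≤-trans (m≤n*m p k) kp≤q

  Win : Player → Position n b → Set
  Win = AvoiderWins p q n b

  live : Position n b → Fin n → Bool
  live s i = en s i ≡ᵇ 0

  module Trim (s : Position n b) = Trimming k p q (live s)
  open Trim using (potential; slack)

  Φ : Position n b → ℕ
  Φ s = potential s (fr s)

  bound : ℕ
  bound = (q ∸ p) * g (suc p)

  -- Free elements in dead boxes; Avoider may take them at no risk.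
  sink : Position n b → ℕ
  sink s = sumOn (not ∘ live s) (fr s)

  liveCount : Position n b → ℕ
  liveCount s = sumOn (live s) (λ _ → 1)

  LiveAtLeast : ℕ → Position n b → Set
  LiveAtLeast x s = ∀ i → live s i ≡ true → x ≤ fr s i

  -- The invariant before Avoider's move …
  InvA : Position n b → Set
  InvA s = LiveAtLeast (suc p) s × Φ s ≤ bound

  -- … and before Enforcer's move: every live box is nonempty, and either
  -- Enforcer must take everything or every move of his restores InvA.
  EnforcerBound : Position n b → Set
  EnforcerBound s = freeCount n b s < q ⊎
    (LiveAtLeast (suc p) s × (∀ M → LegalMove q n b s M → Φ (apply n b enf M s) ≤ bound))

  InvE : Position n b → Set
  InvE s = LiveAtLeast 1 s × EnforcerBound s

  -- With no free element left and a free element in every live box, Avoider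
  -- owns no box: a box he owns would be live and full.
  finish : ∀ pl s → freeCount n b s ≡ 0 → LiveAtLeast 1 s → Win pl s
  finish pl s none-free nonempty = finished none-free λ { (i , owned) →
    <-irrefl (sym (owned-fr s i owned)) (nonempty i (≡0⇒≡ᵇ0 (owned-en s i owned))) }

  -- An Enforcer move M from s: boxes it touches die, so Φ drops by the
  -- weights of the live boxes it touches.
  module EnforcerMove (s : Position n b) (M : ElemSet n b) (onFree : OnFree s M) where
    s' : Position n b
    s' = apply n b enf M s

    still-live : ∀ i → live s' i ≡ true → live s i ≡ true × inBox M i ≡ 0
    still-live i live' = ≡0⇒≡ᵇ0 (m+n≡0⇒m≡0 (en s i) en'≡0) , m+n≡0⇒n≡0 (en s i) en'≡0
      where
      en'≡0 : en s i + inBox M i ≡ 0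
      en'≡0 = trans (sym (enf-en s M onFree i)) (≡ᵇ0⇒≡0 _ live')

    fr-still-live : ∀ i → live s' i ≡ true → fr s' i ≡ fr s i
    fr-still-live i live' = begin
      fr s' i               ≡⟨ sym (+-identityʳ _) ⟩
      fr s' i + 0           ≡⟨ cong (fr s' i +_) (sym (proj₂ (still-live i live'))) ⟩
      fr s' i + inBox M i   ≡⟨ claim-fr enf refl s M onFree i ⟩
      fr s i                ∎
      where open ≡-Reasoning

    inBox≤fr : ∀ i → inBox M i ≤ fr s i
    inBox≤fr i = subst (inBox M i ≤_) (claim-fr enf refl s M onFree i) (m≤n+m _ _)

    lost : Fin n → ℕ
    lost i = if live s i then (if inBox M i ≡ᵇ 0 then 0 else g (fr s i)) else 0

    Φ-drop : Φ s' + sumFin n lost ≡ Φ s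
    Φ-drop = trans (sym (sumFin-+ n _ lost)) (sumFin-cong n box)
      where
      box : ∀ i → (if live s' i then g (fr s' i) else 0) + lost i ≡ (if live s i then g (fr s i) else 0)
      box i = byCases (live s' i) (live s i) (inBox M i ≡ᵇ 0) refl refl refl
        where
        byCases : ∀ x y z → live s' i ≡ x → live s i ≡ y → (inBox M i ≡ᵇ 0) ≡ z →
                  (if x then g (fr s' i) else 0) + (if y then (if z then 0 else g (fr s i)) else 0)
                  ≡ (if y then g (fr s i) else 0)
        byCases true  true  true  live' _ _ = trans (+-identityʳ _) (cong g (fr-still-live i live'))
        byCases true  true  false live' _ touched
          = case trans (sym touched) (≡0⇒≡ᵇ0 (proj₂ (still-live i live'))) of λ ()
        byCases true  false _     live' dead _ = case trans (sym dead) (proj₁ (still-live i live')) of λ ()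
        byCases false false _     _     _ _ = refl
        byCases false true  false _     _ _ = refl
        byCases false true  true  dead' live₀ untouched = case trans (sym dead') (≡0⇒≡ᵇ0 en'≡0) of λ ()
          where
          en'≡0 : en s' i ≡ 0
          en'≡0 = trans (enf-en s M onFree i)
                        (cong₂ _+_ (≡ᵇ0⇒≡0 (en s i) live₀) (≡ᵇ0⇒≡0 (inBox M i) untouched))

    Φ-after≤ : Φ s' ≤ Φ s
    Φ-after≤ = subst (Φ s' ≤_) Φ-drop (m≤m+n _ _)

    lost-per-box : sink s ≡ 0 → ∀ T → (∀ i → live s i ≡ true → fr s i ≤ T) →
                   ∀ i → g T * inBox M i ≤ T * lost i
    lost-per-box no-sink T small i with live s i in live₀
    ... | false = ≤-trans (≤-reflexive (trans (cong (g T *_) inBox≡0) (*-zeroʳ (g T)))) z≤n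
      where
      dead-empty : fr s i ≡ 0
      dead-empty = trans (sym (if-true (cong not live₀)))
                         (sumFin-zero⁻¹ n _ no-sink i)
      inBox≡0 : inBox M i ≡ 0
      inBox≡0 = n≤0⇒n≡0 (subst (inBox M i ≤_) dead-empty (inBox≤fr i))
    ... | true with inBox M i ≡ᵇ 0 in untouched
    ...   | true  = ≤-trans (≤-reflexive (trans (cong (g T *_) (≡ᵇ0⇒≡0 _ untouched)) (*-zeroʳ (g T)))) z≤n
    ...   | false = begin
            g T * inBox M i   ≤⟨ *-monoʳ-≤ (g T) (inBox≤fr i) ⟩
            g T * fr s i      ≤⟨ *-mono-≤ (g-anti (fr s i) T 1≤fr (small i live₀)) (small i live₀) ⟩
            g (fr s i) * T    ≡⟨ *-comm _ T ⟩
            T * g (fr s i)    ∎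
      where
      open ≤-Reasoning
      1≤fr : 1 ≤ fr s i
      1≤fr = ≤-trans (n≢0⇒n>0 (λ eq → case trans (sym untouched) (≡0⇒≡ᵇ0 eq) of λ ()))
                     (inBox≤fr i)

    -- An Enforcer move of at least q elements pays for p trimming steps at size T.
    enforcer-pays : sink s ≡ 0 → q ≤ count n b M → ∀ T → 2 ≤ T →
                    (∀ i → live s i ≡ true → fr s i ≤ T) → Φ s' + p * D T ≤ Φ s
    enforcer-pays no-sink q≤M T 2≤T small = begin
      Φ s' + p * D T       ≤⟨ +-monoʳ-≤ (Φ s') p*D≤lost ⟩
      Φ s' + sumFin n lost ≡⟨ Φ-drop ⟩
      Φ s                  ∎
      where
      open ≤-Reasoning
      instance
        T≢0 : NonZero T
        T≢0 = >-nonZero (≤-trans (s≤s z≤n) 2≤T)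
      p*D≤lost : p * D T ≤ sumFin n lost
      p*D≤lost = *-cancelˡ-≤ T (begin
        T * (p * D T)          ≡⟨ sym (*-assoc T p (D T)) ⟩
        T * p * D T            ≤⟨ D-bound T 2≤T ⟩
        q * g T                ≡⟨ *-comm q (g T) ⟩
        g T * q                ≤⟨ *-monoʳ-≤ (g T) q≤M ⟩
        g T * count n b M      ≡⟨ sym (sumFin-* n (g T) (inBox M)) ⟩
        sumFin n (λ i → g T * inBox M i) ≤⟨ sumFin-mono n (lost-per-box no-sink T small) ⟩
        sumFin n (λ i → T * lost i)      ≡⟨ sumFin-* n T lost ⟩
        T * sumFin n lost      ∎)

  module AvoiderMove (s : Position n b) (d : Fin n → ℕ)
                     (d≤fr : ∀ i → live s i ≡ true → d i ≤ fr s i) where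
    M : ElemSet n b
    M i = if live s i then selFirst (b i) (λ j → isFree (s i j)) (d i) else (λ j → isFree (s i j))

    s' : Position n b
    s' = apply n b avo M s

    onFree : OnFree s M
    onFree i j m with live s i
    ... | true  = isFree-true (selFirst-⊆ (b i) _ (d i) j m)
    ... | false = isFree-true m

    inBox-M : ∀ i → inBox M i ≡ (if live s i then d i else fr s i)
    inBox-M i with live s i in live₀
    ... | true  = trans (selFirst-cnt (b i) _ (d i)) (m≤n⇒m⊓n≡m (d≤fr i live₀))
    ... | false = refl

    M-dead : ∀ i → live s i ≡ false → ∀ j → M i j ≡ isFree (s i j)
    M-dead i dead j rewrite dead = refl

    live-same : ∀ i → live s' i ≡ live s i
    live-same i = cong (_≡ᵇ 0) (avo-en s M onFree i)

    fr-after : ∀ i → fr s' i ≡ (if live s i then fr s i ∸ d i else 0)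
    fr-after i = begin
      fr s' i                                  ≡⟨ sym (m+n∸n≡m (fr s' i) (inBox M i)) ⟩
      fr s' i + inBox M i ∸ inBox M i          ≡⟨ cong₂ _∸_ (claim-fr avo refl s M onFree i) (inBox-M i) ⟩
      fr s i ∸ (if live s i then d i else fr s i) ≡⟨ byCase (live s i) ⟩
      (if live s i then fr s i ∸ d i else 0)   ∎
      where
      open ≡-Reasoning
      byCase : ∀ x → fr s i ∸ (if x then d i else fr s i) ≡ (if x then fr s i ∸ d i else 0)
      byCase true  = refl
      byCase false = n∸n≡0 (fr s i)

    count-M : count n b M ≡ sink s + sumOn (live s) d
    count-M = trans (sumFin-cong n inBox-M) (sumFin-cases (live s) d (fr s))

  record Reply (s : Position n b) : Set where
    field
      move    : ElemSet n b
      legal   : LegalMove p n b s move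
      after   : InvE (apply n b avo move s)
      shrinks : freeCount n b (apply n b avo move s) < freeCount n b s

  weight-or-slack : ∀ t → suc p ≤ t → g (suc p) ≤ g t + g (suc p) * (t ∸ suc p)
  weight-or-slack t p<t with t ∸ suc p in t-excess
  ... | zero  = ≤-trans (≤-reflexive (cong g (≤-antisym p<t (m∸n≡0⇒m≤n t-excess)))) (m≤m+n _ _)
  ... | suc x = ≤-trans (m≤m*n (g (suc p)) (suc x)) (m≤n+m _ (g t))

  fewLiveBoxes : ∀ s → InvA s → slack s (fr s) < p → liveCount s < q
  fewLiveBoxes s (floor , Φ≤bound) slack<p = *-cancelˡ-< (g (suc p)) _ _ (begin-strict
    G * liveCount s                     ≡⟨ sym (sumOn-* (live s) G (λ _ → 1)) ⟩
    sumOn (live s) (λ _ → G * 1)        ≤⟨ sumOn-mono (live s) per-box ⟩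
    sumOn (live s) (λ i → g (fr s i) + G * (fr s i ∸ suc p))
                                        ≡⟨ trans (sumOn-+ (live s) _ _) (cong (Φ s +_) (sumOn-* (live s) G _)) ⟩
    Φ s + G * slack s (fr s)            <⟨ +-mono-≤-< Φ≤bound (*-monoʳ-< G slack<p) ⟩
    (q ∸ p) * G + G * p                 ≡⟨ cong (_+ G * p) (*-comm (q ∸ p) G) ⟩
    G * (q ∸ p) + G * p                 ≡⟨ sym (*-distribˡ-+ G (q ∸ p) p) ⟩
    G * (q ∸ p + p)                     ≡⟨ cong (G *_) (m∸n+n≡m p≤q) ⟩
    G * q                               ∎)
    where
    open ≤-Reasoning
    G : ℕ
    G = g (suc p)
    per-box : ∀ i → live s i ≡ true → G * 1 ≤ g (fr s i) + G * (fr s i ∸ suc p)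
    per-box i li = ≤-trans (≤-reflexive (*-identityʳ G)) (weight-or-slack (fr s i) (floor i li))
    instance
      G≢0 : NonZero G
      G≢0 = >-nonZero (g-pos (suc p))

  -- When little room is left, Avoider leaves one free element in each live
  -- box; there are fewer than q of them, so Enforcer must take them all.
  finishingMove : ∀ s → InvA s → sink s + slack s (fr s) < p → 0 < freeCount n b s → Reply s
  finishingMove s inv@(floor , _) short F>0 = record
    { move = M ; legal = proj₁ legal-shrinks ; after = after ; shrinks = proj₂ legal-shrinks }
    where
    open AvoiderMove s (λ i → pred (fr s i)) (λ _ _ → pred[n]≤n)

    one-left : ∀ i → fr s' i ≡ (if live s i then 1 else 0)
    one-left i = trans (fr-after i) (byCase (live s i) refl)
      where
      byCase : ∀ x → live s i ≡ x → (if x then fr s i ∸ pred (fr s i) else 0) ≡ (if x then 1 else 0)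
      byCase true  li = trans (∸-pred (≤-trans (s≤s z≤n) (floor i li)) ≤-refl)
                              (cong suc (n∸n≡0 (fr s i)))
      byCase false _  = refl

    after : InvE s'
    after = (λ i li' → ≤-reflexive (sym (trans (one-left i) (if-true (trans (sym (live-same i)) li')))))
          , inj₁ (subst (_< q) (sym (sumFin-cong n one-left))
                        (fewLiveBoxes s inv (≤-<-trans (m≤n+m _ (sink s)) short)))

    legal-shrinks : LegalMove p n b s M × freeCount n b s' < freeCount n b s
    legal-shrinks with someOrNone (live s)
    ... | inj₁ (i , li) = large-legal p s M onFree p≤M
                        , claim-shrinks avo refl s M onFree (<-≤-trans (>-nonZero⁻¹ p) p≤M)
      where
      p≤M : p ≤ count n b M
      p≤M = begin
        p                                          ≤⟨ suc[m]≤n⇒m≤pred[n] (floor i li) ⟩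
        pred (fr s i)                              ≤⟨ term≤sumOn (live s) (λ i → pred (fr s i)) i li ⟩
        sumOn (live s) (λ i → pred (fr s i))       ≤⟨ m≤n+m _ (sink s) ⟩
        sink s + sumOn (live s) (λ i → pred (fr s i)) ≡⟨ sym count-M ⟩
        count n b M                                ∎
        where open ≤-Reasoning
    ... | inj₂ none = takeAll-legal p s M onFree
                        (λ i j free-j → trans (M-dead i (none i) j) (cong isFree free-j))
                    , subst (_< freeCount n b s) (sym (trans (sumFin-cong n one-left) no-live)) F>0
      where
      no-live : liveCount s ≡ 0
      no-live = sumOn-zero (live s) (λ i li → case trans (sym (none i)) li of λ ())

  -- Otherwise Avoider takes the free elements of the dead boxes and trims the
  -- live boxes by the remaining e = p - sink elements.
  normalMove : ∀ s → InvA s → p ≤ sink s + slack s (fr s) → Reply s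
  normalMove s (floor , Φ≤bound) enough = record
    { move = M ; legal = large-legal p s M onFree p≤M ; after = after
    ; shrinks = claim-shrinks avo refl s M onFree (<-≤-trans (>-nonZero⁻¹ p) p≤M) }
    where
    e : ℕ
    e = p ∸ sink s
    e≤slack : e ≤ slack s (fr s)
    e≤slack = subst (e ≤_) (m+n∸m≡n (sink s) _) (∸-monoˡ-≤ (sink s) enough)
    open Trim.Trimmed s (Trim.trim s (fr s) e floor e≤slack) renaming (floor to trimmed-floor)
    open AvoiderMove s (λ i → fr s i ∸ result i) (λ i _ → m∸n≤m (fr s i) (result i))

    Tmax : ℕ
    Tmax = maxOn (live s) result

    fr-live : ∀ i → live s i ≡ true → fr s' i ≡ result i
    fr-live i li = trans (fr-after i) (trans (if-true li) (m∸[m∸n]≡n (below i)))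

    p≤M : p ≤ count n b M
    p≤M = subst (p ≤_) (sym (trans count-M (cong (sink s +_) removed≡))) (m≤n+m∸n p (sink s))

    floor' : LiveAtLeast (suc p) s'
    floor' i li' = subst (suc p ≤_) (sym (fr-live i li)) (trimmed-floor i li)
      where
      li : live s i ≡ true
      li = trans (sym (live-same i)) li'

    Φ-after : Φ s' ≤ Φ s + e * D Tmax
    Φ-after = subst (_≤ Φ s + e * D Tmax) (sym Φ-trimmed) potential≤
      where
      Φ-trimmed : Φ s' ≡ potential s result
      Φ-trimmed = trans (sumOn-mask _ live-same) (sumOn-cong (live s) (λ i li → cong g (fr-live i li)))

    -- Enforcer's reply costs him at least what the trimming cost Avoider.
    Φ-reply : ∀ M₂ → LegalMove q n b s' M₂ → q ≤ freeCount n b s' →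
              Φ (apply n b enf M₂ s') ≤ bound
    Φ-reply M₂ legal₂ q≤F' with someOrNone (live s)
    ... | inj₂ none = ≤-trans E.Φ-after≤ (≤-trans (≤-reflexive (sumOn-zero (live s') dead)) z≤n)
      where
      module E = EnforcerMove s' M₂ (proj₁ legal₂)
      dead : ∀ i → live s' i ≡ true → g (fr s' i) ≡ 0
      dead i li' = case trans (sym (none i)) (trans (sym (live-same i)) li') of λ ()
    ... | inj₁ (i₀ , li₀) = +-cancelʳ-≤ (p * D Tmax) _ _ (begin
      Φ E.s' + p * D Tmax      ≤⟨ E.enforcer-pays no-sink (proj₁ (proj₂ legal₂) q≤F') Tmax 2≤Tmax small ⟩
      Φ s'                     ≤⟨ Φ-after ⟩
      Φ s + e * D Tmax         ≤⟨ +-mono-≤ Φ≤bound (*-monoˡ-≤ (D Tmax) (m∸n≤m p (sink s))) ⟩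
      bound + p * D Tmax       ∎)
      where
      open ≤-Reasoning
      module E = EnforcerMove s' M₂ (proj₁ legal₂)
      2≤Tmax : 2 ≤ Tmax
      2≤Tmax = ≤-trans (s≤s (>-nonZero⁻¹ p))
                       (≤-trans (trimmed-floor i₀ li₀) (maxOn-ub (live s) result i₀ li₀))
      no-sink : sink s' ≡ 0
      no-sink = sumOn-zero (not ∘ live s') λ i dead' →
        trans (fr-after i) (if-false (trans (sym (live-same i)) (not-injective dead')))
      small : ∀ i → live s' i ≡ true → fr s' i ≤ Tmax
      small i li' = subst (_≤ Tmax) (sym (fr-live i li)) (maxOn-ub (live s) result i li)
        where
        li : live s i ≡ true
        li = trans (sym (live-same i)) li'

    after : InvE s'
    after = (λ i li' → ≤-trans (s≤s z≤n) (floor' i li'))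
          , (case freeCount n b s' <? q of λ where
               (yes few)  → inj₁ few
               (no  many) → inj₂ (floor' , λ M₂ legal₂ → Φ-reply M₂ legal₂ (≮⇒≥ many)))

  avoiderReply : ∀ s → InvA s → 0 < freeCount n b s → Reply s
  avoiderReply s inv F>0 with p ≤? sink s + slack s (fr s)
  ... | yes enough = normalMove s inv enough
  ... | no  short  = finishingMove s inv (≰⇒> short) F>0

  zeroOrPos : ∀ m → m ≡ 0 ⊎ 0 < m
  zeroOrPos zero    = inj₁ refl
  zeroOrPos (suc _) = inj₂ z<s

  winA : ∀ N s → freeCount n b s < N → InvA s → Win Avoider s
  winE : ∀ N s → freeCount n b s < N → InvE s → Win Enforcer s

  winA (suc N) s F≤N inv with zeroOrPos (freeCount n b s)
  ... | inj₁ F≡0 = finish Avoider s F≡0 (λ i li → ≤-trans (s≤s z≤n) (proj₁ inv i li))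
  ... | inj₂ F>0 = avoMove F>0 move legal (winE N _ (<-≤-trans shrinks (s≤s⁻¹ F≤N)) after)
    where open Reply (avoiderReply s inv F>0)

  winE (suc N) s F≤N (nonempty , few-or-bounded) with zeroOrPos (freeCount n b s)
  ... | inj₁ F≡0 = finish Enforcer s F≡0 nonempty
  ... | inj₂ F>0 = enfMove F>0 (λ M legal → reply M legal few-or-bounded)
    where
    reply : ∀ M → LegalMove q n b s M → EnforcerBound s → Win Avoider (apply n b enf M s)
    reply M legal@(onFree , _ , takes-all) (inj₁ few) =
      finish Avoider _ (claim-all enf refl s M (takes-all few)) every-box-dead
      where
      -- Enforcer took an element of every live box.
      every-box-dead : LiveAtLeast 1 (apply n b enf M s)
      every-box-dead i li' with EnforcerMove.still-live s M onFree i li'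
      ... | li , untouched with fr-witness s i (nonempty i li)
      ...   | j , free-j =
              ⊥-elim (<-irrefl (sym untouched) (cnt-pos (b i) (M i) j (takes-all few i j free-j)))
    reply M legal@(onFree , _ , _) (inj₂ (floor , bounded)) = winA N _ F'<N (floor' , bounded M legal)
      where
      floor' : LiveAtLeast (suc p) (apply n b enf M s)
      floor' i li' = subst (suc p ≤_) (sym (EnforcerMove.fr-still-live s M onFree i li'))
                           (floor i (proj₁ (EnforcerMove.still-live s M onFree i li')))
      F'<N : freeCount n b (apply n b enf M s) < N
      F'<N = <-≤-trans (claim-shrinks enf refl s M onFree (legal-nonempty q s M q>0 legal F>0))
                       (s≤s⁻¹ F≤N)
        where
        q>0 : 0 < q
        q>0 = <-≤-trans (>-nonZero⁻¹ p) p≤q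

  -- Enforcer's moves never raise Φ, so Avoider's invariant implies Enforcer's.
  InvA⇒InvE : ∀ s → InvA s → InvE s
  InvA⇒InvE s (floor , Φ≤bound) =
    (λ i li → ≤-trans (s≤s z≤n) (floor i li)) ,
    inj₂ (floor , λ M legal → ≤-trans (EnforcerMove.Φ-after≤ s M (proj₁ legal)) Φ≤bound)

  wins : ∀ s → InvA s → Win Avoider s × Win Enforcer s
  wins s inv = winA _ s (n<1+n _) inv , winE _ s (n<1+n _) (InvA⇒InvE s inv)

  -- In the initial position every box is live, with weight g(k) as bᵢ ≥ k.
  initial-InvA : p < k → (∀ i → k ≤ b i) →
                 n * a ^ (k ∸ p ∸ 1) ≤ (q ∸ p) * c ^ (k ∸ p ∸ 1) → InvA (initial n b)
  initial-InvA p<k big few-boxes = floor , (begin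
    Φ s₀                                 ≡⟨ sumFin-cong n (λ i → trans (if-true (all-live i)) (g-initial i)) ⟩
    sumFin n (λ _ → g k)                 ≡⟨ sumFin-const n (g k) ⟩
    n * g k                              ≡⟨ cong (n *_) g-top ⟩
    n * (a ^ m * a ^ p)                  ≡⟨ sym (*-assoc n _ _) ⟩
    n * a ^ m * a ^ p                    ≤⟨ *-monoˡ-≤ (a ^ p) few-boxes' ⟩
    (q ∸ p) * c ^ m * a ^ p              ≡⟨ *-assoc (q ∸ p) _ _ ⟩
    (q ∸ p) * (c ^ m * a ^ p)            ≡⟨ cong ((q ∸ p) *_) (sym (g-below (suc p) p<k)) ⟩
    bound                                ∎)
    where
    open ≤-Reasoning
    s₀ : Position n b
    s₀ = initial n b
    m : ℕ
    m = k ∸ suc p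

    few-boxes' : n * a ^ m ≤ (q ∸ p) * c ^ m
    few-boxes' = subst (λ x → n * a ^ x ≤ (q ∸ p) * c ^ x)
                       (trans (∸-+-assoc k p 1) (cong (k ∸_) (+-comm p 1))) few-boxes

    g-top : g k ≡ a ^ m * a ^ p
    g-top = begin-equality
      g k                 ≡⟨ g-below k ≤-refl ⟩
      c ^ (k ∸ k) * a ^ pred k ≡⟨ cong₂ (λ x y → c ^ x * a ^ y) (n∸n≡0 k) pred-k ⟩
      1 * a ^ (m + p)     ≡⟨ *-identityˡ _ ⟩
      a ^ (m + p)         ≡⟨ ^-distribˡ-+-* a m p ⟩
      a ^ m * a ^ p       ∎
      where
      pred-k : pred k ≡ m + p
      pred-k = cong pred (trans (sym (m∸n+n≡m p<k)) (+-suc m p))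

    fr-initial : ∀ i → fr s₀ i ≡ b i
    fr-initial i = trans (sumFin-const (b i) 1) (*-identityʳ (b i))

    all-live : ∀ i → live s₀ i ≡ true
    all-live i = ≡0⇒≡ᵇ0 (sumFin-zero (b i) (λ _ → refl))

    g-initial : ∀ i → g (fr s₀ i) ≡ g k
    g-initial i = trans (cong g (fr-initial i)) (g-beyond (b i) (big i))

    floor : LiveAtLeast (suc p) s₀
    floor i _ = subst (suc p ≤_) (sym (fr-initial i)) (≤-trans p<k (big i))

-- The initial position satisfies InvA.
theorem1p6 : (p q k n : ℕ) → 0 < p → 0 < q → 0 < k → 0 < n →
    k > p → q ≥ k * p →
    n * (k * p) ^ (k ∸ p ∸ 1) ≤ (q ∸ p) * (q + k * p) ^ (k ∸ p ∸ 1) →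
    (b : Fin n → ℕ) → ((i : Fin n) → k ≤ b i) →
    ((i j : Fin n) → i F.≤ j → b i ≤ b j) →
    AvoiderWins p q n b Avoider (initial n b) × AvoiderWins p q n b Enforcer (initial n b)
theorem1p6 p q k n 0<p _ 0<k _ p<k kp≤q few-boxes b big _ =
  wins (initial n b) (initial-InvA p<k big few-boxes)
  where open Strategy k p q {{>-nonZero 0<k}} {{>-nonZero 0<p}} kp≤q n b
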